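{- For every $n$, $$\{\sigma\in\mathrm{DA}_n:\sigma\text{ is Baxter}\}=\mathrm{DA}_n(2413,3142)=\mathrm{DA}_n(2413)=\mathrm{DA}_n(3142).$$
   Context: A word $w$ is alternating if $w_{2i-1}<w_{2i}$ and $w_{2i}>w_{2i+1}$ whenever these indices exist. A permutation is doubly alternating if it and its inverse are alternating in one-line notation; $\mathrm{DA}_n$ is the set of doubly alternating permutations in $\mathcal S_n$. $\mathrm{DA}_n(\pi_1,\dots,\pi_t)$ is the set of those that avoid each pattern $\pi_j$. Here $\sigma$ contains $\pi\in\mathcal S_m$ if there are indices $i_1<\dots<i_m$ with $\sigma(i_a)<\sigma(i_b)\iff\pi(a)<\pi(b)$. A permutation $\sigma=\sigma_1\cdots\sigma_n$ is Baxter if for all $1\le i<j<k<l\le n$: - if $\sigma_i+1=\sigma_l$ and $\sigma_j>\sigma_l$, then $\sigma_k>\sigma_l$; - if $\sigma_l+1=\sigma_i$ and $\sigma_k>\sigma_i$, then $\sigma_j>\sigma_i$. -}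

module Defs where

open import Data.Nat using (ℕ; zero; suc; _%_)
open import Data.Fin using (Fin; toℕ; _<_; _>_)
open import Data.Fin.Permutation using (Permutation′; _⟨$⟩ʳ_; _⟨$⟩ˡ_)
open import Data.Vec using (Vec; []; _∷_; lookup)
open import Data.Product using (_×_; Σ; ∃)
open import Relation.Binary.PropositionalEquality using (_≡_)
open import Relation.Nullary using (¬_)
open import Function.Bundles using (_⇔_)

-- A word w of length n (positions are 0-indexed here; position i ↔ paper's i+1).
Alternating : {n : ℕ} → (Fin n → Fin n) → Set
Alternating {n} w = ∀ (i j : Fin n) → toℕ j ≡ suc (toℕ i) →
  (toℕ i % 2 ≡ 0 → w i < w j) × (toℕ i % 2 ≡ 1 → w i > w j)

DoublyAlternating : {n : ℕ} → Permutation′ n → Set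
DoublyAlternating σ = Alternating (σ ⟨$⟩ʳ_) × Alternating (σ ⟨$⟩ˡ_)

Contains : {n m : ℕ} → Permutation′ n → (Fin m → Fin m) → Set
Contains {n} {m} σ π = Σ (Fin m → Fin n) λ f →
  (∀ (a b : Fin m) → a < b → f a < f b) ×
  (∀ (a b : Fin m) → ((σ ⟨$⟩ʳ f a) < (σ ⟨$⟩ʳ f b)) ⇔ (π a < π b))

Avoids : {n m : ℕ} → Permutation′ n → (Fin m → Fin m) → Set
Avoids σ π = ¬ Contains σ π

-- Patterns 2413 and 3142 (values shifted to 0-indexed: 1302 and 2031).
p2413 : Fin 4 → Fin 4
p2413 = lookup (Data.Fin.suc Data.Fin.zero ∷ Data.Fin.suc (Data.Fin.suc (Data.Fin.suc Data.Fin.zero))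
               ∷ Data.Fin.zero ∷ Data.Fin.suc (Data.Fin.suc Data.Fin.zero) ∷ [])

p3142 : Fin 4 → Fin 4
p3142 = lookup (Data.Fin.suc (Data.Fin.suc Data.Fin.zero) ∷ Data.Fin.zero
               ∷ Data.Fin.suc (Data.Fin.suc (Data.Fin.suc Data.Fin.zero)) ∷ Data.Fin.suc Data.Fin.zero ∷ [])

-- Baxter permutations (value shift by one is irrelevant for σ_i + 1 = σ_l).
Baxter : {n : ℕ} → Permutation′ n → Set
Baxter {n} σ = ∀ (i j k l : Fin n) → i < j → j < k → k < l →
  (toℕ (σ ⟨$⟩ʳ l) ≡ suc (toℕ (σ ⟨$⟩ʳ i)) → (σ ⟨$⟩ʳ j) > (σ ⟨$⟩ʳ l) → (σ ⟨$⟩ʳ k) > (σ ⟨$⟩ʳ l)) ×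
  (toℕ (σ ⟨$⟩ʳ i) ≡ suc (toℕ (σ ⟨$⟩ʳ l)) → (σ ⟨$⟩ʳ k) > (σ ⟨$⟩ʳ i) → (σ ⟨$⟩ʳ j) > (σ ⟨$⟩ʳ i))

-- A Baxter violation is exactly a 2413 or 3142 occurrence that is tight: its two middle
-- entries are adjacent in position and its two outer entries adjacent in value.  So avoiding
-- both patterns gives Baxter, and the work is to show, for doubly alternating σ, that a
-- 2413 occurrence forces a tight one and that a tight 2413 forces a tight 3142 (3142 for σ
-- being 2413 for σ⁻¹, which is again doubly alternating, this closes the circle).
--
-- Draw the graph of σ as a path through the points (i, σ i) and the graph of σ⁻¹ as a path
-- through the same points in order of value.  The ascents of σ sit at even positions, those
-- of σ⁻¹ at even values, and each ascent step of one path is crossed by an ascent step of the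
-- other.  A 2413 occurrence spans a box; while some entry has its value inside the box but its
-- position outside (or vice versa), move a side of the box inward to it, keeping a 2413.  When
-- this stops the box is closed under σ and σ⁻¹, its sides have forced parities, and
-- it has more ascents of σ than even value steps, so two ascents cross the same value step,
-- and between them the path of σ descends through that step: a tight 2413.  Two crossings in
-- one column give a tight 3142 in the same way.  A tight 2413 puts two crossings on one value
-- step; if no column held two, the ⌊n/2⌋ even value steps would need ⌊n/2⌋ + 1 columns
-- among the ⌊n/2⌋ ascents of σ.
module Submission where

open import Defs

open import Data.Empty using (⊥; ⊥-elim)
open import Data.Fin using (Fin; toℕ; fromℕ<)
import Data.Fin as F
open import Data.Fin.Patterns using (0F; 1F; 2F; 3F)
open import Data.Fin.Permutation using (Permutation′; _⟨$⟩ʳ_; _⟨$⟩ˡ_; inverseˡ; inverseʳ)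
import Data.Fin.Properties as Fin
open import Data.Nat
  using (ℕ; zero; suc; pred; ⌊_/2⌋; _+_; _*_; _∸_; _≤_; _<_; _%_; z≤n; s≤s; s≤s⁻¹; z<s; _≟_; _<?_)
open import Data.Nat.DivMod using (m*n%n≡0; [m+kn]%n≡m%n)
open import Data.Nat.Induction using (<-wellFounded)
open import Data.Nat.Properties
open import Data.Product using (∃; ∃₂; ∃-syntax; _×_; _,_; proj₁; proj₂; map; map₂)
open import Data.Sum using (_⊎_; inj₁; inj₂)
open import Data.Vec using ([]; _∷_; lookup)
open import Function using (_∘_)
open import Function.Bundles using (_⇔_; mk⇔; Equivalence)
open import Induction.WellFounded using (Acc; acc)
open import Relation.Binary.Definitions using (tri<; tri≈; tri>)
open import Relation.Binary.PropositionalEquality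
open import Relation.Nullary using (¬_; Dec; yes; no; contradiction)
open import Relation.Nullary.Decidable using (decidable-stable; ¬?; _×-dec_)
open import Relation.Unary using (Decidable)

switch-up : ∀ {q} {Q : ℕ → Set q} → Decidable Q → ∀ {lo} hi → lo ≤ hi → ¬ Q lo → Q hi →
  ∃[ y ] lo ≤ y × y < hi × ¬ Q y × Q (suc y)
switch-up Q? zero z≤n ¬Qlo Qhi = contradiction Qhi ¬Qlo
switch-up {Q = Q} Q? {lo} (suc h) lo≤1+h ¬Qlo Q1+h = step (Q? h)
  where
  lo≤h : lo ≤ h
  lo≤h = s≤s⁻¹ (≤∧≢⇒< lo≤1+h λ { refl → ¬Qlo Q1+h })
  step : Dec (Q h) → ∃[ y ] lo ≤ y × y < suc h × ¬ Q y × Q (suc y)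
  step (no ¬Qh) = h , lo≤h , ≤-refl , ¬Qh , Q1+h
  step (yes Qh) =
    let y , lo≤y , y<h , ¬Qy , Q1+y = switch-up Q? h lo≤h ¬Qlo Qh
    in y , lo≤y , m<n⇒m<1+n y<h , ¬Qy , Q1+y

switch-down : ∀ {q} {Q : ℕ → Set q} → Decidable Q → ∀ {lo} hi → lo ≤ hi → Q lo → ¬ Q hi →
  ∃[ y ] lo ≤ y × y < hi × Q y × ¬ Q (suc y)
switch-down Q? hi lo≤hi Qlo ¬Qhi =
  let y , lo≤y , y<hi , ¬¬Qy , ¬Q1+y = switch-up (λ x → ¬? (Q? x)) hi lo≤hi (λ ¬Qlo → ¬Qlo Qlo) ¬Qhi
  in y , lo≤y , y<hi , decidable-stable (Q? y) ¬¬Qy , ¬Q1+y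

pigeonhole-interval : ∀ {r} (R : ℕ → ℕ → Set r) {lo hi lo′ hi′} → hi′ ∸ lo′ < hi ∸ lo →
  (∀ t → lo ≤ t → t < hi → ∃[ u ] lo′ ≤ u × u < hi′ × R t u) →
  ∃[ t₁ ] ∃[ t₂ ] ∃[ u ] lo ≤ t₁ × t₁ < t₂ × t₂ < hi × R t₁ u × R t₂ u
pigeonhole-interval R {lo} {hi} {lo′} {hi′} M<N image =
  let i , j , i<j , fi≡fj = Fin.pigeonhole M<N f
  in lo + toℕ i , lo + toℕ j , u i , m≤m+n lo (toℕ i) , +-monoʳ-< lo i<j , inside j ,
     R-image i , subst (R (lo + toℕ j)) (sym (same-image fi≡fj)) (R-image j)
  where
  lo<hi : lo < hi
  lo<hi = ∸-cancelʳ-< {o = hi} (subst (_< hi ∸ lo) (sym (n∸n≡0 hi)) (≤-<-trans z≤n M<N))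
  inside : (w : Fin (hi ∸ lo)) → lo + toℕ w < hi
  inside w = subst (lo + toℕ w <_) (m+[n∸m]≡n (<⇒≤ lo<hi)) (+-monoʳ-< lo (Fin.toℕ<n w))
  pick : (w : Fin (hi ∸ lo)) → ∃[ u ] lo′ ≤ u × u < hi′ × R (lo + toℕ w) u
  pick w = image (lo + toℕ w) (m≤m+n lo (toℕ w)) (inside w)
  u : Fin (hi ∸ lo) → ℕ
  u w = proj₁ (pick w)
  lo′≤u : ∀ w → lo′ ≤ u w
  lo′≤u w = proj₁ (proj₂ (pick w))
  R-image : ∀ w → R (lo + toℕ w) (u w)
  R-image w = proj₂ (proj₂ (proj₂ (pick w)))
  f : Fin (hi ∸ lo) → Fin (hi′ ∸ lo′)
  f w = fromℕ< (∸-monoˡ-< (proj₁ (proj₂ (proj₂ (pick w)))) (lo′≤u w))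
  same-image : ∀ {v w} → f v ≡ f w → u v ≡ u w
  same-image fv≡fw =
    ∸-cancelʳ-≡ (lo′≤u _) (lo′≤u _)
      (trans (sym (Fin.toℕ-fromℕ< _)) (trans (cong toℕ fv≡fw) (Fin.toℕ-fromℕ< _)))

injection-interval-size : (f : ℕ → ℕ) {a d j k : ℕ} →
  (∀ v → a < v → v < d → j < f v × f v < k) →
  (∀ {u v} → u < d → v < d → f u ≡ f v → u ≡ v) →
  d ∸ suc a ≤ k ∸ suc j
injection-interval-size f {a} {d} {j} {k} maps-into injective = ≮⇒≥ λ too-small →
  let t₁ , t₂ , _ , _ , t₁<t₂ , t₂<d , ft₁≡u , ft₂≡u =
        pigeonhole-interval (λ v u → f v ≡ u) too-small
          (λ v a<v v<d → let j<fv , fv<k = maps-into v a<v v<d in f v , j<fv , fv<k , refl)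
  in <⇒≢ t₁<t₂ (injective (<-trans t₁<t₂ t₂<d) t₂<d (trans ft₁≡u (sym ft₂≡u)))

even-or-odd : ∀ x → (∃[ h ] x ≡ 2 * h) ⊎ (∃[ h ] x ≡ suc (2 * h))
even-or-odd zero = inj₁ (0 , refl)
even-or-odd (suc zero) = inj₂ (0 , refl)
even-or-odd (suc (suc x)) with even-or-odd x
... | inj₁ (h , x≡2h) = inj₁ (suc h , trans (cong (2 +_) x≡2h) (sym (*-suc 2 h)))
... | inj₂ (h , x≡1+2h) = inj₂ (suc h , trans (cong (2 +_) x≡1+2h) (cong suc (sym (*-suc 2 h))))

2*h%2≡0 : ∀ h → (2 * h) % 2 ≡ 0
2*h%2≡0 h = trans (cong (_% 2) (*-comm 2 h)) (m*n%n≡0 h 2)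

[1+2*h]%2≡1 : ∀ h → suc (2 * h) % 2 ≡ 1
[1+2*h]%2≡1 h = trans (cong (λ m → suc m % 2) (*-comm 2 h)) ([m+kn]%n≡m%n 1 h 2)

1+2u<n⇒u<⌊n/2⌋ : ∀ {u} n → suc (2 * u) < n → u < ⌊ n /2⌋
1+2u<n⇒u<⌊n/2⌋ zero ()
1+2u<n⇒u<⌊n/2⌋ (suc zero) (s≤s ())
1+2u<n⇒u<⌊n/2⌋ {zero} (suc (suc n)) _ = z<s
1+2u<n⇒u<⌊n/2⌋ {suc u} (suc (suc n)) 3+2u<2+n =
  s≤s (1+2u<n⇒u<⌊n/2⌋ n (s≤s⁻¹ (s≤s⁻¹ (subst (_< 2 + n) (cong suc (*-suc 2 u)) 3+2u<2+n))))

u<⌊n/2⌋⇒1+2u<n : ∀ {u} n → u < ⌊ n /2⌋ → suc (2 * u) < n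
u<⌊n/2⌋⇒1+2u<n {zero} (suc (suc n)) _ = s≤s (s≤s z≤n)
u<⌊n/2⌋⇒1+2u<n {suc u} (suc (suc n)) u<⌊n/2⌋ =
  subst (_< 2 + n) (cong suc (sym (*-suc 2 u))) (s≤s (s≤s (u<⌊n/2⌋⇒1+2u<n n (s≤s⁻¹ u<⌊n/2⌋))))

pred-<-of-≤ : ∀ {m n} → m ≤ n → 0 < n → pred m < n
pred-<-of-≤ {zero} _ 0<n = 0<n
pred-<-of-≤ {suc m} m<n _ = m<n

halve-gap : ∀ A D J K → 2 * D ∸ 2 * A ≤ 2 * K ∸ 2 * J → J < K → D ∸ suc A < K ∸ J
halve-gap A D J K gap≤ J<K =
  subst (_< K ∸ J) (pred[m∸n]≡m∸[1+n] D A) (pred-<-of-≤ half-gap≤ (m<n⇒0<n∸m J<K))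
  where
  half-gap≤ : D ∸ A ≤ K ∸ J
  half-gap≤ = *-cancelˡ-≤ 2 (subst₂ _≤_ (sym (*-distribˡ-∸ 2 D A)) (sym (*-distribˡ-∸ 2 K J)) gap≤)

AlternatingBelow : ℕ → (ℕ → ℕ) → Set
AlternatingBelow n f = ∀ x → suc x < n →
  (x % 2 ≡ 0 → f x < f (suc x)) × (x % 2 ≡ 1 → f (suc x) < f x)

module _ {n} {f : ℕ → ℕ} (alt : AlternatingBelow n f) where

  ascent-at-even : ∀ h → suc (2 * h) < n → f (2 * h) < f (suc (2 * h))
  ascent-at-even h <n = proj₁ (alt (2 * h) <n) (2*h%2≡0 h)

  ascent⇒even : ∀ {x} → suc x < n → f x < f (suc x) → ∃[ h ] x ≡ 2 * h
  ascent⇒even {x} <n ascent with even-or-odd x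
  ... | inj₁ even = even
  ... | inj₂ (h , refl) = contradiction (proj₂ (alt x <n) ([1+2*h]%2≡1 h)) (<-asym ascent)

  descent⇒odd : ∀ {x} → suc x < n → f (suc x) < f x → ∃[ h ] x ≡ suc (2 * h)
  descent⇒odd {x} <n descent with even-or-odd x
  ... | inj₂ odd = odd
  ... | inj₁ (h , refl) = contradiction (proj₁ (alt x <n) (2*h%2≡0 h)) (<-asym descent)

record AlternatingInverses (n : ℕ) : Set where
  field
    s p : ℕ → ℕ
    s<n : ∀ {x} → x < n → s x < n
    p<n : ∀ {y} → y < n → p y < n
    p∘s : ∀ {x} → x < n → p (s x) ≡ x
    s∘p : ∀ {y} → y < n → s (p y) ≡ y
    s-alternating : AlternatingBelow n s
    p-alternating : AlternatingBelow n p

inverse : ∀ {n} → AlternatingInverses n → AlternatingInverses n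
inverse P = record
  { s = p ; p = s ; s<n = p<n ; p<n = s<n ; p∘s = s∘p ; s∘p = p∘s
  ; s-alternating = p-alternating ; p-alternating = s-alternating }
  where open AlternatingInverses P

record Box : Set where
  constructor box
  field
    j k a d : ℕ

module Crossings {n} (P : AlternatingInverses n) where

  open AlternatingInverses P

  p-of : ∀ {x y} → x < n → s x ≡ y → p y ≡ x
  p-of x<n refl = p∘s x<n

  p-injective : ∀ {x y} → x < n → y < n → p x ≡ p y → x ≡ y
  p-injective {x} x<n y<n px≡py = trans (sym (s∘p x<n)) (trans (cong s px≡py) (s∘p y<n))

  -- The step of s from x to x + 1 crosses the step of p from y to y + 1.
  Crossing : ℕ → ℕ → Set
  Crossing x y = suc x < n × suc y < n × p y ≤ x × x < p (suc y) × s x ≤ y × y < s (suc x)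

  -- A 2413 occurrence at positions p a < j < k < p d, recorded by its middle positions and
  -- its outer values.
  Framed : Box → Set
  Framed (box j k a d) = p a < j × j < k × k < p d × p d < n × s k < a × a < d × d < s j

  Tight : ℕ → ℕ → Set
  Tight x y = Framed (box x (suc x) y (suc y))

  Enclosed : Box → Set
  Enclosed (box j k a d) =
    (∀ v → a < v → v < d → j < p v × p v < k) × (∀ x → j < x → x < k → a < s x × s x < d)

  size : Box → ℕ
  size (box j k a d) = (d ∸ a) + (k ∸ j)

  crossing-at-ascent : ∀ {x} → suc x < n → s x < s (suc x) → ∃[ y ] Crossing x y
  crossing-at-ascent {x} 1+x<n ascent =
    let y , sx≤y , y<s1+x , x≮py , x<p1+y =
          switch-up (λ y → x <? p y) (s (suc x)) (<⇒≤ ascent)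
            (<-irrefl (sym (p∘s (<-trans (n<1+n x) 1+x<n)))) (subst (x <_) (sym (p∘s 1+x<n)) ≤-refl)
    in y , 1+x<n , ≤-<-trans y<s1+x (s<n 1+x<n) , ≮⇒≥ x≮py , x<p1+y , sx≤y , y<s1+x

  crossing-column-even : ∀ {x y} → Crossing x y → ∃[ t ] x ≡ 2 * t
  crossing-column-even (1+x<n , _ , _ , _ , sx≤y , y<s1+x) =
    ascent⇒even s-alternating 1+x<n (≤-<-trans sx≤y y<s1+x)

  crossing-row-even : ∀ {x y} → Crossing x y → ∃[ h ] y ≡ 2 * h
  crossing-row-even (_ , 1+y<n , py≤x , x<p1+y , _ , _) =
    ascent⇒even p-alternating 1+y<n (≤-<-trans py≤x x<p1+y)

  tight-between-crossings : ∀ {x₁ x₂ y} → Crossing x₁ y → Crossing x₂ y → x₁ < x₂ → ∃₂ Tight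
  tight-between-crossings {y = y}
    (_ , 1+y<n , py≤x₁ , _ , _ , y<s1+x₁) (1+x₂<n , _ , _ , x₂<p1+y , sx₂≤y , _) x₁<x₂ =
    let x , x₁<x , x<x₂ , y<sx , y≮s1+x = switch-down (λ x → y <? s x) _ x₁<x₂ y<s1+x₁ (≤⇒≯ sx₂≤y)
        1+x<n = ≤-<-trans x<x₂ (<-trans (n<1+n _) 1+x₂<n)
        py<x = ≤-<-trans py≤x₁ x₁<x
        x<p1+y = <-trans x<x₂ x₂<p1+y
    in x , y , py<x , ≤-refl , ≤-<-trans x<x₂ x₂<p1+y , p<n 1+y<n ,
       ≤∧≢⇒< (≮⇒≥ y≮s1+x) (λ s1+x≡y → <⇒≢ (<-trans py<x (n<1+n x)) (p-of 1+x<n s1+x≡y)) , ≤-refl ,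
       ≤∧≢⇒< y<sx (λ 1+y≡sx → <⇒≢ x<p1+y (sym (p-of (<-trans (n<1+n x) 1+x<n) (sym 1+y≡sx))))

  shrink-bottom : ∀ {j k a d v} → Framed (box j k a d) → a < v → v < d → p v < j →
    Framed (box j k v d) × size (box j k v d) < size (box j k a d)
  shrink-bottom {j} {k} (_ , j<k , k<pd , pd<n , sk<a , _ , d<sj) a<v v<d pv<j =
    (pv<j , j<k , k<pd , pd<n , <-trans sk<a a<v , v<d , d<sj) ,
    +-monoˡ-< (k ∸ j) (∸-monoʳ-< a<v (<⇒≤ v<d))

  shrink-top : ∀ {j k a d v} → Framed (box j k a d) → a < v → v < d → k < p v →
    Framed (box j k a v) × size (box j k a v) < size (box j k a d)
  shrink-top {j} {k} (pa<j , j<k , k<pd , pd<n , sk<a , _ , d<sj) a<v v<d k<pv =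
    (pa<j , j<k , k<pv , p<n v<n , sk<a , a<v , <-trans v<d d<sj) ,
    +-monoˡ-< (k ∸ j) (∸-monoˡ-< v<d (<⇒≤ a<v))
    where
    v<n = <-trans v<d (<-trans d<sj (s<n (<-trans j<k (<-trans k<pd pd<n))))

  shrink-left : ∀ {j k a d x} → Framed (box j k a d) → j < x → x < k → d < s x →
    Framed (box x k a d) × size (box x k a d) < size (box j k a d)
  shrink-left {a = a} {d} (pa<j , _ , k<pd , pd<n , sk<a , a<d , _) j<x x<k d<sx =
    (<-trans pa<j j<x , x<k , k<pd , pd<n , sk<a , a<d , d<sx) ,
    +-monoʳ-< (d ∸ a) (∸-monoʳ-< j<x (<⇒≤ x<k))

  shrink-right : ∀ {j k a d x} → Framed (box j k a d) → j < x → x < k → s x < a →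
    Framed (box j x a d) × size (box j x a d) < size (box j k a d)
  shrink-right {a = a} {d} (pa<j , _ , k<pd , pd<n , _ , a<d , d<sj) j<x x<k sx<a =
    (pa<j , j<x , <-trans x<k k<pd , pd<n , sx<a , a<d , d<sj) ,
    +-monoʳ-< (d ∸ a) (∸-monoˡ-< x<k (<⇒≤ j<x))

  enclosed-when-stuck : ∀ {j k a d} → Framed (box j k a d) →
    (∀ v → a < v → v < d → ¬ p v < j) → (∀ v → a < v → v < d → ¬ k < p v) →
    (∀ x → j < x → x < k → ¬ d < s x) → (∀ x → j < x → x < k → ¬ s x < a) →
    Enclosed (box j k a d)
  enclosed-when-stuck (pa<j , j<k , k<pd , pd<n , sk<a , a<d , d<sj) ¬bottom ¬top ¬left ¬right =
    (λ v a<v v<d →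
      let v<n = <-trans v<d (<-trans d<sj (s<n (<-trans j<k k<n)))
      in ≤∧≢⇒< (≮⇒≥ (¬bottom v a<v v<d))
           (λ j≡pv → <⇒≢ (<-trans v<d d<sj) (trans (sym (s∘p v<n)) (cong s (sym j≡pv)))) ,
         ≤∧≢⇒< (≮⇒≥ (¬top v a<v v<d))
           (λ pv≡k → <⇒≢ (<-trans sk<a a<v) (trans (cong s (sym pv≡k)) (s∘p v<n)))) ,
    (λ x j<x x<k →
      let x<n = <-trans x<k k<n
      in ≤∧≢⇒< (≮⇒≥ (¬right x j<x x<k)) (λ a≡sx → <⇒≢ (<-trans pa<j j<x) (p-of x<n (sym a≡sx))) ,
         ≤∧≢⇒< (≮⇒≥ (¬left x j<x x<k)) (λ sx≡d → <⇒≢ (<-trans x<k k<pd) (sym (p-of x<n sx≡d))))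
    where
    k<n = <-trans k<pd pd<n

  refine : ∀ b → Framed b → Enclosed b ⊎ ∃[ b′ ] Framed b′ × size b′ < size b
  refine (box j k a d) fr
    with anyUpTo? (λ v → a <? v ×-dec p v <? j) d
       | anyUpTo? (λ v → a <? v ×-dec k <? p v) d
       | anyUpTo? (λ x → j <? x ×-dec d <? s x) k
       | anyUpTo? (λ x → j <? x ×-dec s x <? a) k
  ... | yes (v , v<d , a<v , pv<j) | _ | _ | _ = inj₂ (box j k v d , shrink-bottom fr a<v v<d pv<j)
  ... | _ | yes (v , v<d , a<v , k<pv) | _ | _ = inj₂ (box j k a v , shrink-top fr a<v v<d k<pv)
  ... | _ | _ | yes (x , x<k , j<x , d<sx) | _ = inj₂ (box x k a d , shrink-left fr j<x x<k d<sx)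
  ... | _ | _ | _ | yes (x , x<k , j<x , sx<a) = inj₂ (box j x a d , shrink-right fr j<x x<k sx<a)
  ... | no ¬bottom | no ¬top | no ¬left | no ¬right = inj₁ (enclosed-when-stuck fr
    (λ v a<v v<d pv<j → ¬bottom (v , v<d , a<v , pv<j)) (λ v a<v v<d k<pv → ¬top (v , v<d , a<v , k<pv))
    (λ x j<x x<k d<sx → ¬left (x , x<k , j<x , d<sx)) (λ x j<x x<k sx<a → ¬right (x , x<k , j<x , sx<a)))

  enclose : ∀ b → Framed b → ∃[ b′ ] Framed b′ × Enclosed b′
  enclose b fr = go b fr (<-wellFounded (size b))
    where
    go : ∀ b → Framed b → Acc _<_ (size b) → ∃[ b′ ] Framed b′ × Enclosed b′
    go b fr (acc smaller) with refine b fr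
    ... | inj₁ enc = b , fr , enc
    ... | inj₂ (b′ , fr′ , size′<size) = go b′ fr′ (smaller size′<size)

  -- p maps the 2(D − A) values of the box into its 2(K − J) positions, so the K − J ascents 2t
  -- inside it are crossed by only D − A − 1 < K − J even value steps 2h.
  tight-in-box : ∀ {j k a d} → ∃[ J ] j ≡ suc (2 * J) → ∃[ K ] k ≡ 2 + 2 * K → ∃[ A ] a ≡ 2 * A →
    ∃[ D ] d ≡ suc (2 * D) → Enclosed (box j k a d) → suc j < k → k < n → d ≤ n → ∃₂ Tight
  tight-in-box (J , refl) (K , refl) (A , refl) (D , refl) (in-positions , in-values) 1+j<k k<n d≤n =
    let t₁ , t₂ , h , _ , t₁<t₂ , _ , cross₁ , cross₂ =
          pigeonhole-interval (λ t h → Crossing (2 * t) (2 * h)) rows<columns crossing-in-column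
    in tight-between-crossings cross₁ cross₂ (*-monoʳ-< 2 t₁<t₂)
    where
    rows<columns : D ∸ suc A < suc K ∸ suc J
    rows<columns = halve-gap A D J K
      (injection-interval-size p in-positions (λ u<d v<d → p-injective (<-≤-trans u<d d≤n) (<-≤-trans v<d d≤n)))
      (*-cancelˡ-< 2 J K (s≤s⁻¹ (s≤s⁻¹ 1+j<k)))
    column-bounds : ∀ {t} → suc J ≤ t → t < suc K → suc (2 * J) < 2 * t × suc (2 * t) < 2 + 2 * K
    column-bounds {t} J<t t≤K =
      subst (_≤ 2 * t) (*-suc 2 J) (*-monoʳ-≤ 2 J<t) , s≤s (s≤s (*-monoʳ-≤ 2 (s≤s⁻¹ t≤K)))
    crossing-in-column : ∀ t → suc J ≤ t → t < suc K → ∃[ h ] suc A ≤ h × h < D × Crossing (2 * t) (2 * h)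
    crossing-in-column t J<t t≤K
      with j<x , 1+x<k ← column-bounds J<t t≤K
      with crossing-at-ascent (<-trans 1+x<k k<n) (ascent-at-even s-alternating t (<-trans 1+x<k k<n))
    ... | y , cross@(_ , _ , _ , _ , sx≤y , y<s1+x) with crossing-row-even cross
    ... | h , refl =
      let a<sx , _ = in-values (2 * t) j<x (<-trans (n<1+n _) 1+x<k)
          _ , s1+x<d = in-values (suc (2 * t)) (<-trans j<x (n<1+n _)) 1+x<k
      in h , *-cancelˡ-< 2 A h (<-≤-trans a<sx sx≤y) , *-cancelˡ-< 2 h D (<-≤-trans y<s1+x (s≤s⁻¹ s1+x<d)) , cross

  wide-box-tight : ∀ {j k a d} → Framed (box j k a d) → Enclosed (box j k a d) → suc j < k → ∃₂ Tight
  wide-box-tight {k = zero} (_ , () , _) _ _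
  wide-box-tight {d = zero} (_ , _ , _ , _ , _ , () , _) _ _
  wide-box-tight {j} {suc k′} {a} {suc d′} (pa<j , _ , k<pd , pd<n , sk<a , _ , d<sj) enc 1+j<k =
    tight-in-box (descent⇒odd s-alternating (<-trans 1+j<k k<n) (<-trans s1+j<d d<sj))
                 (map₂ (cong suc) (descent⇒odd s-alternating k<n (<-trans sk<a a<sk′)))
                 (ascent⇒even p-alternating (<-trans 1+a<d d<n) (<-trans pa<j j<p1+a))
                 (map₂ (cong suc) (ascent⇒even p-alternating d<n (<-trans pd′<k k<pd)))
                 enc 1+j<k k<n (<⇒≤ d<n)
    where
    in-positions = proj₁ enc
    in-values = proj₂ enc
    k<n = <-trans k<pd pd<n
    d<n = <-trans d<sj (s<n (<-trans (n<1+n j) (<-trans 1+j<k k<n)))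
    j<k′ = s≤s⁻¹ 1+j<k
    s1+j<d = proj₂ (in-values (suc j) ≤-refl 1+j<k)
    a<sk′ = proj₁ (in-values k′ j<k′ ≤-refl)
    1+a<d = ≤-<-trans (proj₁ (in-values (suc j) ≤-refl 1+j<k)) s1+j<d
    j<p1+a = proj₁ (in-positions (suc a) ≤-refl 1+a<d)
    pd′<k = proj₂ (in-positions d′ (s≤s⁻¹ 1+a<d) ≤-refl)

  adjacent-box-tight : ∀ {j a d} → Framed (box j (suc j) a d) → Enclosed (box j (suc j) a d) → Tight j a
  adjacent-box-tight fr@(_ , _ , _ , _ , _ , a<d , _) (in-positions , _) with m≤n⇒m<n∨m≡n a<d
  ... | inj₂ refl = fr
  ... | inj₁ 1+a<d =
    let j<pv , pv<1+j = in-positions _ ≤-refl 1+a<d in contradiction (s≤s⁻¹ pv<1+j) (<⇒≱ j<pv)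

  enclosed-box-tight : ∀ b → Framed b → Enclosed b → ∃₂ Tight
  enclosed-box-tight (box j k a d) fr@(_ , j<k , _) enc with m≤n⇒m<n∨m≡n j<k
  ... | inj₁ 1+j<k = wide-box-tight fr enc 1+j<k
  ... | inj₂ refl = j , a , adjacent-box-tight fr enc

  framed-box-tight : ∀ b → Framed b → ∃₂ Tight
  framed-box-tight b fr = let b′ , fr′ , enc′ = enclose b fr in enclosed-box-tight b′ fr′ enc′

  framed? : ∀ b → Dec (Framed b)
  framed? (box j k a d) =
    p a <? j ×-dec j <? k ×-dec k <? p d ×-dec p d <? n ×-dec s k <? a ×-dec a <? d ×-dec d <? s j

  tight? : Dec (∃₂ Tight)
  tight? with anyUpTo? (λ x → anyUpTo? (λ y → framed? (box x (suc x) y (suc y))) n) n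
  ... | yes (x , _ , y , _ , tight) = yes (x , y , tight)
  ... | no none = no λ { (x , y , tight@(_ , _ , 1+x<p1+y , p1+y<n , _ , _ , 1+y<sx)) →
    none (x , <-trans (<-trans (n<1+n x) 1+x<p1+y) p1+y<n ,
          y , <-trans (<-trans (n<1+n y) 1+y<sx) (s<n (<-trans (<-trans (n<1+n x) 1+x<p1+y) p1+y<n)) , tight) }

  crossing-column-index : ∀ {x y} → Crossing x y → ∃[ t ] x ≡ 2 * t × t < ⌊ n /2⌋
  crossing-column-index cross@(1+x<n , _) with crossing-column-even cross
  ... | t , refl = t , refl , 1+2u<n⇒u<⌊n/2⌋ n 1+x<n

  tight-row-crossed-twice : ∀ {x y} → Tight x y →
    ∃₂ λ x₁ x₂ → x₁ < x₂ × Crossing x₁ y × Crossing x₂ y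
  tight-row-crossed-twice {x} {y} (py<x , _ , 1+x<p1+y , p1+y<n , s1+x<y , _ , 1+y<sx) =
    let x₁ , py≤x₁ , x₁<x , y≮sx₁ , y<s1+x₁ =
          switch-up (λ x → y <? s x) x (<⇒≤ py<x) (<-irrefl (sym (s∘p y<n))) (<-trans (n<1+n y) 1+y<sx)
        x₂ , 1+x≤x₂ , x₂<p1+y , y≮sx₂ , y<s1+x₂ =
          switch-up (λ x → y <? s x) (p (suc y)) (<⇒≤ 1+x<p1+y) (<-asym s1+x<y)
            (subst (y <_) (sym (s∘p 1+y<n)) ≤-refl)
    in x₁ , x₂ , <-≤-trans x₁<x (<⇒≤ 1+x≤x₂) ,
       (≤-<-trans x₁<x x<n , 1+y<n , py≤x₁ , <-trans x₁<x (<-trans (n<1+n x) 1+x<p1+y) ,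
        ≮⇒≥ y≮sx₁ , y<s1+x₁) ,
       (≤-<-trans x₂<p1+y p1+y<n , 1+y<n , ≤-trans (<⇒≤ py<x) (<⇒≤ 1+x≤x₂) , x₂<p1+y ,
        ≮⇒≥ y≮sx₂ , y<s1+x₂)
    where
    x<n = <-trans (<-trans (n<1+n x) 1+x<p1+y) p1+y<n
    1+y<n = <-trans 1+y<sx (s<n x<n)
    y<n = <-trans (n<1+n y) 1+y<n

module Duality {n} (P : AlternatingInverses n) where

  open AlternatingInverses P
  open Crossings P
  module Inv = Crossings (inverse P)

  transpose : ∀ {x y} → Inv.Crossing y x → Crossing x y
  transpose (1+y<n , 1+x<n , sx≤y , y<s1+x , py≤x , x<p1+y) = 1+x<n , 1+y<n , py≤x , x<p1+y , sx≤y , y<s1+x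

  transpose⁻¹ : ∀ {x y} → Crossing x y → Inv.Crossing y x
  transpose⁻¹ (1+x<n , 1+y<n , py≤x , x<p1+y , sx≤y , y<s1+x) = 1+y<n , 1+x<n , sx≤y , y<s1+x , py≤x , x<p1+y

  column-crossed-once : ¬ ∃₂ Inv.Tight → ∀ {x y₁ y₂} → Crossing x y₁ → Crossing x y₂ → y₁ ≡ y₂
  column-crossed-once no-tight {y₁ = y₁} {y₂} cross₁ cross₂ with <-cmp y₁ y₂
  ... | tri< y₁<y₂ _ _ =
    contradiction (Inv.tight-between-crossings (transpose⁻¹ cross₁) (transpose⁻¹ cross₂) y₁<y₂) no-tight
  ... | tri≈ _ y₁≡y₂ _ = y₁≡y₂
  ... | tri> _ _ y₂<y₁ =
    contradiction (Inv.tight-between-crossings (transpose⁻¹ cross₂) (transpose⁻¹ cross₁) y₂<y₁) no-tight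

  row-crossing : ∀ {u} → u < ⌊ n /2⌋ → ∃[ x ] Crossing x (2 * u)
  row-crossing {u} u<⌊n/2⌋ =
    let 1+2u<n = u<⌊n/2⌋⇒1+2u<n n u<⌊n/2⌋
        x , cross = Inv.crossing-at-ascent 1+2u<n (ascent-at-even p-alternating u 1+2u<n)
    in x , transpose cross

  row-not-crossed-twice : ¬ ∃₂ Inv.Tight →
    ∀ {x₁ x₂ y₀} → x₁ < x₂ → Crossing x₁ y₀ → Crossing x₂ y₀ → ⊥
  row-not-crossed-twice no-tight {x₁} {x₂} {y₀} x₁<x₂ cross₁ cross₂ =
    let _ , _ , t , _ , u₁<u₂ , u₂<1+H , assigned₁ , assigned₂ = pigeonhole-interval Assigned ≤-refl assign
    in collision {t = t} u₁<u₂ u₂<1+H assigned₁ assigned₂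
    where
    H = ⌊ n /2⌋
    once = column-crossed-once no-tight
    -- Row u < H is the value step 2u (through x₁ when it is y₀); u = H is the crossing at x₂.
    Assigned : ℕ → ℕ → Set
    Assigned u t = (u < H → Crossing (2 * t) (2 * u) × (2 * u ≡ y₀ → 2 * t ≡ x₁)) × (H ≤ u → 2 * t ≡ x₂)
    assign : ∀ u → 0 ≤ u → u < suc H → ∃[ t ] 0 ≤ t × t < H × Assigned u t
    assign u _ _ with u <? H
    ... | no u≮H = let t₂ , x₂≡2t₂ , t₂<H = crossing-column-index cross₂
      in t₂ , z≤n , t₂<H , (λ u<H → contradiction u<H u≮H) , (λ _ → sym x₂≡2t₂)
    ... | yes u<H with 2 * u ≟ y₀
    ...   | yes 2u≡y₀ = let t₁ , x₁≡2t₁ , t₁<H = crossing-column-index cross₁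
      in t₁ , z≤n , t₁<H , (λ _ → subst₂ Crossing x₁≡2t₁ (sym 2u≡y₀) cross₁ , λ _ → sym x₁≡2t₁) ,
         (λ H≤u → contradiction u<H (≤⇒≯ H≤u))
    ...   | no 2u≢y₀ = let x , cross = row-crossing u<H
                           t , x≡2t , t<H = crossing-column-index cross
      in t , z≤n , t<H ,
         (λ _ → subst (λ x → Crossing x (2 * u)) x≡2t cross , λ 2u≡y₀ → contradiction 2u≡y₀ 2u≢y₀) ,
         (λ H≤u → contradiction u<H (≤⇒≯ H≤u))
    collision : ∀ {u₁ u₂ t} → u₁ < u₂ → u₂ < suc H → Assigned u₁ t → Assigned u₂ t → ⊥
    collision {u₂ = u₂} u₁<u₂ u₂<1+H (assigned₁ , _) (assigned₂ , last₂)
      with assigned₁ (<-≤-trans u₁<u₂ (s≤s⁻¹ u₂<1+H)) | u₂ <? H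
    ... | cross-u₁ , _ | yes u₂<H = <⇒≢ (*-monoʳ-< 2 u₁<u₂) (once cross-u₁ (proj₁ (assigned₂ u₂<H)))
    ... | cross-u₁ , pinned | no u₂≮H =
      let 2t≡x₂ = last₂ (≮⇒≥ u₂≮H)
          2u₁≡y₀ = once cross-u₁ (subst (λ x → Crossing x y₀) (sym 2t≡x₂) cross₂)
      in <⇒≢ x₁<x₂ (trans (sym (pinned 2u₁≡y₀)) 2t≡x₂)

  tight⇒inverse-tight : ∃₂ Tight → ∃₂ Inv.Tight
  tight⇒inverse-tight (_ , _ , tight) with Inv.tight?
  ... | yes inverse-tight = inverse-tight
  ... | no no-tight =
    let _ , _ , x₁<x₂ , cross₁ , cross₂ = tight-row-crossed-twice tight
    in ⊥-elim (row-not-crossed-twice no-tight x₁<x₂ cross₁ cross₂)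

-- Junk value 0 outside [0, n).
extend : ∀ {n} → (Fin n → Fin n) → ℕ → ℕ
extend {n} w x with x <? n
... | yes x<n = toℕ (w (fromℕ< x<n))
... | no _ = 0

module _ {n : ℕ} where

  extend-fromℕ< : ∀ (w : Fin n → Fin n) {x} (x<n : x < n) → extend w x ≡ toℕ (w (fromℕ< x<n))
  extend-fromℕ< w {x} x<n with x <? n
  ... | yes _ = refl
  ... | no x≮n = contradiction x<n x≮n

  extend-toℕ : ∀ (w : Fin n → Fin n) i → extend w (toℕ i) ≡ toℕ (w i)
  extend-toℕ w i = trans (extend-fromℕ< w (Fin.toℕ<n i)) (cong (toℕ ∘ w) (Fin.fromℕ<-toℕ i _))

  extend<n : ∀ (w : Fin n → Fin n) {x} → x < n → extend w x < n
  extend<n w x<n = subst (_< n) (sym (extend-fromℕ< w x<n)) (Fin.toℕ<n _)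

  extend-inverse : ∀ {w v : Fin n → Fin n} → (∀ {i} → v (w i) ≡ i) →
    ∀ {x} → x < n → extend v (extend w x) ≡ x
  extend-inverse {w} {v} v∘w {x} x<n = begin
    extend v (extend w x)           ≡⟨ cong (extend v) (extend-fromℕ< w x<n) ⟩
    extend v (toℕ (w (fromℕ< x<n))) ≡⟨ extend-toℕ v (w (fromℕ< x<n)) ⟩
    toℕ (v (w (fromℕ< x<n)))        ≡⟨ cong toℕ v∘w ⟩
    toℕ (fromℕ< x<n)                ≡⟨ Fin.toℕ-fromℕ< x<n ⟩
    x                               ∎
    where open ≡-Reasoning

  extend-alternating : ∀ {w : Fin n → Fin n} → Alternating w → AlternatingBelow n (extend w)
  extend-alternating {w} alt x 1+x<n = at (<-trans (n<1+n x) 1+x<n)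
    where
    at : x < n → (x % 2 ≡ 0 → extend w x < extend w (suc x)) × (x % 2 ≡ 1 → extend w (suc x) < extend w x)
    at x<n rewrite extend-fromℕ< w x<n | extend-fromℕ< w 1+x<n =
      map (_∘ same-parity) (_∘ same-parity)
        (alt (fromℕ< x<n) (fromℕ< 1+x<n) (trans (Fin.toℕ-fromℕ< 1+x<n) (cong suc (sym (Fin.toℕ-fromℕ< x<n)))))
      where
      same-parity : ∀ {r} → x % 2 ≡ r → toℕ (fromℕ< x<n) % 2 ≡ r
      same-parity = trans (cong (_% 2) (Fin.toℕ-fromℕ< x<n))

alternating-inverses : ∀ {n} (σ : Permutation′ n) → DoublyAlternating σ → AlternatingInverses n
alternating-inverses σ (σ-alternating , σ⁻¹-alternating) = record
  { s = extend (σ ⟨$⟩ʳ_) ; p = extend (σ ⟨$⟩ˡ_)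
  ; s<n = extend<n (σ ⟨$⟩ʳ_) ; p<n = extend<n (σ ⟨$⟩ˡ_)
  ; p∘s = extend-inverse (inverseˡ σ) ; s∘p = extend-inverse (inverseʳ σ)
  ; s-alternating = extend-alternating σ-alternating ; p-alternating = extend-alternating σ⁻¹-alternating }

record Chain {a ℓ} {A : Set a} (_≺_ : A → A → Set ℓ) (f : Fin 4 → A) : Set ℓ where
  constructor chain
  field
    first : f 0F ≺ f 1F
    second : f 1F ≺ f 2F
    third : f 2F ≺ f 3F

chain-monotone : ∀ {a ℓ} {A : Set a} {_≺_ : A → A → Set ℓ} → (∀ {x y z} → x ≺ y → y ≺ z → x ≺ z) →
  ∀ {f} → Chain _≺_ f → ∀ {a b} → a F.< b → f a ≺ f b
chain-monotone _ _ {b = 0F} ()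
chain-monotone _ (chain c₀ _ _) {0F} {1F} _ = c₀
chain-monotone _ _ {F.suc _} {1F} (s≤s ())
chain-monotone ≺-trans (chain c₀ c₁ _) {0F} {2F} _ = ≺-trans c₀ c₁
chain-monotone _ (chain _ c₁ _) {1F} {2F} _ = c₁
chain-monotone _ _ {F.suc (F.suc _)} {2F} (s≤s (s≤s ()))
chain-monotone ≺-trans (chain c₀ c₁ c₂) {0F} {3F} _ = ≺-trans c₀ (≺-trans c₁ c₂)
chain-monotone ≺-trans (chain _ c₁ c₂) {1F} {3F} _ = ≺-trans c₁ c₂
chain-monotone _ (chain _ _ c₂) {2F} {3F} _ = c₂
chain-monotone _ _ {3F} {3F} (s≤s (s≤s (s≤s ())))

chain-cong : ∀ {a ℓ} {A : Set a} {_≺_ : A → A → Set ℓ} {f g : Fin 4 → A} →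
  (∀ i → f i ≡ g i) → Chain _≺_ f → Chain _≺_ g
chain-cong {_≺_ = _≺_} f≗g (chain c₀ c₁ c₂) =
  chain (subst₂ _≺_ (f≗g 0F) (f≗g 1F) c₀) (subst₂ _≺_ (f≗g 1F) (f≗g 2F) c₁)
        (subst₂ _≺_ (f≗g 2F) (f≗g 3F) c₂)

toℕ-chain : ∀ {m} {q : Fin 4 → Fin m} → Chain F._<_ q → Chain _<_ (toℕ ∘ q)
toℕ-chain (chain c₀ c₁ c₂) = chain c₀ c₁ c₂

fromℕ-chain : ∀ {m} {q : Fin 4 → Fin m} → Chain _<_ (toℕ ∘ q) → Chain F._<_ q
fromℕ-chain (chain c₀ c₁ c₂) = chain c₀ c₁ c₂

p2413∘p3142 : ∀ a → p2413 (p3142 a) ≡ a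
p2413∘p3142 0F = refl
p2413∘p3142 1F = refl
p2413∘p3142 2F = refl
p2413∘p3142 3F = refl

p3142∘p2413 : ∀ a → p3142 (p2413 a) ≡ a
p3142∘p2413 0F = refl
p3142∘p2413 1F = refl
p3142∘p2413 2F = refl
p3142∘p2413 3F = refl

module _ {n} (σ : Permutation′ n) {π π⁻¹ : Fin 4 → Fin 4}
         (π⁻¹∘π : ∀ a → π⁻¹ (π a) ≡ a) (π∘π⁻¹ : ∀ a → π (π⁻¹ a) ≡ a) where

  contains⇔chains : Contains σ π ⇔ (∃[ q ] Chain F._<_ q × Chain F._<_ (λ a → σ ⟨$⟩ʳ q (π⁻¹ a)))
  contains⇔chains = mk⇔ to from
    where
    to : Contains σ π → ∃[ q ] Chain F._<_ q × Chain F._<_ (λ a → σ ⟨$⟩ʳ q (π⁻¹ a))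
    to (q , increasing , order) =
      q , chain (increasing 0F 1F 0<1) (increasing 1F 2F 1<2) (increasing 2F 3F 2<3) ,
      chain (value< 0<1) (value< 1<2) (value< 2<3)
      where
      0<1 = s≤s z≤n
      1<2 = s≤s (s≤s z≤n)
      2<3 = s≤s (s≤s (s≤s z≤n))
      value< : ∀ {a b} → a F.< b → σ ⟨$⟩ʳ q (π⁻¹ a) F.< σ ⟨$⟩ʳ q (π⁻¹ b)
      value< {a} {b} a<b =
        Equivalence.from (order (π⁻¹ a) (π⁻¹ b)) (subst₂ F._<_ (sym (π∘π⁻¹ a)) (sym (π∘π⁻¹ b)) a<b)
    from : ∃[ q ] Chain F._<_ q × Chain F._<_ (λ a → σ ⟨$⟩ʳ q (π⁻¹ a)) → Contains σ π
    from (q , positions , values) =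
      q , (λ a b → chain-monotone Fin.<-trans positions {a} {b}) , λ a b → mk⇔ (reflect a b) (preserve a b)
      where
      preserve : ∀ a b → π a F.< π b → σ ⟨$⟩ʳ q a F.< σ ⟨$⟩ʳ q b
      preserve a b πa<πb =
        subst₂ (λ x y → σ ⟨$⟩ʳ q x F.< σ ⟨$⟩ʳ q y) (π⁻¹∘π a) (π⁻¹∘π b)
          (chain-monotone Fin.<-trans values {π a} {π b} πa<πb)
      reflect : ∀ a b → σ ⟨$⟩ʳ q a F.< σ ⟨$⟩ʳ q b → π a F.< π b
      reflect a b σqa<σqb with Fin.<-cmp (π a) (π b)
      ... | tri< πa<πb _ _ = πa<πb
      ... | tri≈ _ πa≡πb _ =
        let a≡b = trans (sym (π⁻¹∘π a)) (trans (cong π⁻¹ πa≡πb) (π⁻¹∘π b))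
        in contradiction σqa<σqb (Fin.<-irrefl (cong (λ x → σ ⟨$⟩ʳ q x) a≡b))
      ... | tri> _ _ πb<πa = contradiction σqa<σqb (Fin.<-asym (preserve b a πb<πa))

avoiders-are-Baxter : ∀ {n} (σ : Permutation′ n) → Avoids σ p2413 → Avoids σ p3142 → Baxter σ
avoiders-are-Baxter σ avoids2413 avoids3142 i j k l i<j j<k k<l = clause₁ , clause₂
  where
  V : Fin _ → ℕ
  V a = toℕ (σ ⟨$⟩ʳ a)
  distinct : ∀ {a b} → a F.< b → V a ≢ V b
  distinct {a} {b} a<b Va≡Vb = Fin.<-irrefl (begin
    a                       ≡⟨ inverseˡ σ ⟨
    σ ⟨$⟩ˡ (σ ⟨$⟩ʳ a)        ≡⟨ cong (σ ⟨$⟩ˡ_) (Fin.toℕ-injective Va≡Vb) ⟩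
    σ ⟨$⟩ˡ (σ ⟨$⟩ʳ b)        ≡⟨ inverseˡ σ ⟩
    b                       ∎) a<b
    where open ≡-Reasoning
  q : Fin 4 → Fin _
  q = lookup (i ∷ j ∷ k ∷ l ∷ [])
  positions : Chain F._<_ q
  positions = chain i<j j<k k<l
  clause₁ : V l ≡ suc (V i) → V l < V j → V l < V k
  clause₁ l≡1+i l<j with V l <? V k
  ... | yes l<k = l<k
  ... | no l≮k = contradiction
    (Equivalence.from (contains⇔chains σ {p2413} {p3142} p3142∘p2413 p2413∘p3142) (q , positions , chain k<i i<l l<j))
    avoids2413
    where
    k<l′ = ≤∧≢⇒< (≮⇒≥ l≮k) (distinct k<l)
    k<i = ≤∧≢⇒< (s≤s⁻¹ (subst (V k <_) l≡1+i k<l′)) (λ k≡i → distinct (Fin.<-trans i<j j<k) (sym k≡i))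
    i<l = subst (V i <_) (sym l≡1+i) ≤-refl
  clause₂ : V i ≡ suc (V l) → V i < V k → V i < V j
  clause₂ i≡1+l i<k with V i <? V j
  ... | yes i<j′ = i<j′
  ... | no i≮j = contradiction
    (Equivalence.from (contains⇔chains σ {p3142} {p2413} p2413∘p3142 p3142∘p2413) (q , positions , chain j<l l<i i<k))
    avoids3142
    where
    j<i = ≤∧≢⇒< (≮⇒≥ i≮j) (λ j≡i → distinct i<j (sym j≡i))
    j<l = ≤∧≢⇒< (s≤s⁻¹ (subst (V j <_) i≡1+l j<i)) (distinct (Fin.<-trans j<k k<l))
    l<i = subst (V l <_) (sym i≡1+l) ≤-refl

module DoublyAlternatingPermutation {n} (σ : Permutation′ n) (da : DoublyAlternating σ) where

  P = alternating-inverses σ da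
  open AlternatingInverses P
  module Fwd = Crossings P
  -- A 3142 occurrence of σ is a 2413 occurrence of σ⁻¹.
  module Bwd = Crossings (inverse P)

  Occurs : (Fin 4 → Fin 4) → (Fin 4 → ℕ) → Set
  Occurs π⁻¹ x = Chain _<_ x × x 3F < n × Chain _<_ (λ a → s (x (π⁻¹ a)))

  chains⇔occurs : ∀ {π⁻¹} →
    (∃[ q ] Chain F._<_ q × Chain F._<_ (λ a → σ ⟨$⟩ʳ q (π⁻¹ a))) ⇔ ∃ (Occurs π⁻¹)
  chains⇔occurs {π⁻¹} = mk⇔ to from
    where
    to : (∃[ q ] Chain F._<_ q × Chain F._<_ (λ a → σ ⟨$⟩ʳ q (π⁻¹ a))) → ∃ (Occurs π⁻¹)
    to (q , positions , values) =
      toℕ ∘ q , toℕ-chain positions , Fin.toℕ<n (q 3F) ,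
      chain-cong (λ a → sym (extend-toℕ (σ ⟨$⟩ʳ_) (q (π⁻¹ a)))) (toℕ-chain values)
    from : ∃ (Occurs π⁻¹) → ∃[ q ] Chain F._<_ q × Chain F._<_ (λ a → σ ⟨$⟩ʳ q (π⁻¹ a))
    from (x , positions@(chain x₀<x₁ x₁<x₂ x₂<x₃) , x₃<n , values) =
      q , fromℕ-chain (chain-cong (λ a → sym (Fin.toℕ-fromℕ< (x<n a))) positions) ,
      fromℕ-chain (chain-cong (λ a → extend-fromℕ< (σ ⟨$⟩ʳ_) (x<n (π⁻¹ a))) values)
      where
      x<n : ∀ a → x a < n
      x<n 0F = <-trans x₀<x₁ (<-trans x₁<x₂ (<-trans x₂<x₃ x₃<n))
      x<n 1F = <-trans x₁<x₂ (<-trans x₂<x₃ x₃<n)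
      x<n 2F = <-trans x₂<x₃ x₃<n
      x<n 3F = x₃<n
      q : Fin 4 → Fin n
      q a = fromℕ< (x<n a)

  contains⇔occurs : ∀ {π π⁻¹} → (∀ a → π⁻¹ (π a) ≡ a) → (∀ a → π (π⁻¹ a) ≡ a) →
    Contains σ π ⇔ ∃ (Occurs π⁻¹)
  contains⇔occurs π⁻¹∘π π∘π⁻¹ = mk⇔
    (Equivalence.to chains⇔occurs ∘ Equivalence.to (contains⇔chains σ π⁻¹∘π π∘π⁻¹))
    (Equivalence.from (contains⇔chains σ π⁻¹∘π π∘π⁻¹) ∘ Equivalence.from chains⇔occurs)

  contains2413⇔occurs : Contains σ p2413 ⇔ ∃ (Occurs p3142)
  contains2413⇔occurs = contains⇔occurs p3142∘p2413 p2413∘p3142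

  contains3142⇔occurs : Contains σ p3142 ⇔ ∃ (Occurs p2413)
  contains3142⇔occurs = contains⇔occurs p2413∘p3142 p3142∘p2413

  occurs2413⇒framed : ∀ {x} → Occurs p3142 x → Fwd.Framed (box (x 1F) (x 2F) (s (x 0F)) (s (x 3F)))
  occurs2413⇒framed {x} (chain x₀<x₁ x₁<x₂ x₂<x₃ , x₃<n , chain sx₂<sx₀ sx₀<sx₃ sx₃<sx₁) =
    subst (_< x 1F) (sym (p∘s x₀<n)) x₀<x₁ , x₁<x₂ , subst (x 2F <_) (sym (p∘s x₃<n)) x₂<x₃ ,
    subst (_< n) (sym (p∘s x₃<n)) x₃<n , sx₂<sx₀ , sx₀<sx₃ , sx₃<sx₁
    where
    x₀<n = <-trans x₀<x₁ (<-trans x₁<x₂ (<-trans x₂<x₃ x₃<n))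

  framed⇒occurs2413 : ∀ {j k a d} → Fwd.Framed (box j k a d) → Occurs p3142 (lookup (p a ∷ j ∷ k ∷ p d ∷ []))
  framed⇒occurs2413 {j} {k} (pa<j , j<k , k<pd , pd<n , sk<a , a<d , d<sj) =
    chain pa<j j<k k<pd , pd<n ,
    chain (subst (s k <_) (sym (s∘p a<n)) sk<a) (subst₂ _<_ (sym (s∘p a<n)) (sym (s∘p d<n)) a<d)
          (subst (_< s j) (sym (s∘p d<n)) d<sj)
    where
    d<n = <-trans d<sj (s<n (<-trans j<k (<-trans k<pd pd<n)))
    a<n = <-trans a<d d<n

  occurs3142⇒framed : ∀ {x} → Occurs p2413 x → Bwd.Framed (box (s (x 3F)) (s (x 0F)) (x 1F) (x 2F))
  occurs3142⇒framed {x} (chain x₀<x₁ x₁<x₂ x₂<x₃ , x₃<n , chain sx₁<sx₃ sx₃<sx₀ sx₀<sx₂) =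
    sx₁<sx₃ , sx₃<sx₀ , sx₀<sx₂ , s<n (<-trans x₂<x₃ x₃<n) ,
    subst (_< x 1F) (sym (p∘s x₀<n)) x₀<x₁ , x₁<x₂ , subst (x 2F <_) (sym (p∘s x₃<n)) x₂<x₃
    where
    x₀<n = <-trans x₀<x₁ (<-trans x₁<x₂ (<-trans x₂<x₃ x₃<n))

  framed⇒occurs3142 : ∀ {j k a d} → Bwd.Framed (box j k a d) → Occurs p2413 (lookup (p k ∷ a ∷ d ∷ p j ∷ []))
  framed⇒occurs3142 {j} {k} {a} {d} (sa<j , j<k , k<sd , sd<n , pk<a , a<d , d<pj) =
    chain pk<a a<d d<pj , p<n j<n ,
    chain (subst (s a <_) (sym (s∘p j<n)) sa<j) (subst₂ _<_ (sym (s∘p j<n)) (sym (s∘p k<n)) j<k)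
          (subst (_< s d) (sym (s∘p k<n)) k<sd)
    where
    k<n = <-trans k<sd sd<n
    j<n = <-trans j<k k<n

  contains2413⇒tight : Contains σ p2413 → ∃₂ Fwd.Tight
  contains2413⇒tight contains =
    let _ , occurs = Equivalence.to contains2413⇔occurs contains
    in Fwd.framed-box-tight _ (occurs2413⇒framed occurs)

  tight⇒contains2413 : ∃₂ Fwd.Tight → Contains σ p2413
  tight⇒contains2413 (_ , _ , tight) = Equivalence.from contains2413⇔occurs (_ , framed⇒occurs2413 tight)

  contains3142⇒tight : Contains σ p3142 → ∃₂ Bwd.Tight
  contains3142⇒tight contains =
    let _ , occurs = Equivalence.to contains3142⇔occurs contains
    in Bwd.framed-box-tight _ (occurs3142⇒framed occurs)

  tight⇒contains3142 : ∃₂ Bwd.Tight → Contains σ p3142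
  tight⇒contains3142 (_ , _ , tight) = Equivalence.from contains3142⇔occurs (_ , framed⇒occurs3142 tight)

  contains2413⇒contains3142 : Contains σ p2413 → Contains σ p3142
  contains2413⇒contains3142 = tight⇒contains3142 ∘ Duality.tight⇒inverse-tight P ∘ contains2413⇒tight

  contains3142⇒contains2413 : Contains σ p3142 → Contains σ p2413
  contains3142⇒contains2413 = tight⇒contains2413 ∘ Duality.tight⇒inverse-tight (inverse P) ∘ contains3142⇒tight

  Baxter⇒ℕ : Baxter σ → ∀ {i j k l} → i < j → j < k → k < l → l < n →
    s l ≡ suc (s i) → s l < s j → s l < s k
  Baxter⇒ℕ baxter {i} {j} {k} {l} i<j j<k k<l l<n sl≡1+si sl<sj =
    subst₂ _<_ (sym (value l<n)) (sym (value k<n))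
      (proj₁ (baxter (fromℕ< i<n) (fromℕ< j<n) (fromℕ< k<n) (fromℕ< l<n)
                     (position i<n j<n i<j) (position j<n k<n j<k) (position k<n l<n k<l))
        (subst₂ (λ a b → a ≡ suc b) (value l<n) (value i<n) sl≡1+si) (subst₂ _<_ (value l<n) (value j<n) sl<sj))
    where
    k<n = <-trans k<l l<n
    j<n = <-trans j<k k<n
    i<n = <-trans i<j j<n
    value : ∀ {x} (x<n : x < n) → s x ≡ toℕ (σ ⟨$⟩ʳ fromℕ< x<n)
    value = extend-fromℕ< (σ ⟨$⟩ʳ_)
    position : ∀ {x y} (x<n : x < n) (y<n : y < n) → x < y → fromℕ< x<n F.< fromℕ< y<n
    position x<n y<n = subst₂ _<_ (sym (Fin.toℕ-fromℕ< x<n)) (sym (Fin.toℕ-fromℕ< y<n))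

  Baxter⇒no-tight : Baxter σ → ¬ ∃₂ Fwd.Tight
  Baxter⇒no-tight baxter (x , y , py<x , _ , 1+x<p1+y , p1+y<n , s1+x<y , _ , 1+y<sx) =
    <-irrefl refl (<-trans s1+x<y (<-trans (n<1+n y) (subst (_< s (suc x)) (s∘p 1+y<n) sl<sk)))
    where
    1+y<n = <-trans 1+y<sx (s<n (<-trans (<-trans (n<1+n x) 1+x<p1+y) p1+y<n))
    sl<sk = Baxter⇒ℕ baxter py<x ≤-refl 1+x<p1+y p1+y<n
              (trans (s∘p 1+y<n) (cong suc (sym (s∘p (<-trans (n<1+n y) 1+y<n)))))
              (subst (_< s x) (sym (s∘p 1+y<n)) 1+y<sx)

corollary4p4 : (n : ℕ) (σ : Permutation′ n) → DoublyAlternating σ →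
    (Baxter σ ⇔ (Avoids σ p2413 × Avoids σ p3142)) ×
    ((Avoids σ p2413 × Avoids σ p3142) ⇔ Avoids σ p2413) ×
    (Avoids σ p2413 ⇔ Avoids σ p3142)
corollary4p4 n σ da =
  mk⇔ (λ baxter → avoids2413 baxter , avoids2413 baxter ∘ contains3142⇒contains2413)
      (λ (avoids2413 , avoids3142) → avoiders-are-Baxter σ avoids2413 avoids3142) ,
  mk⇔ proj₁ (λ avoids2413 → avoids2413 , avoids2413 ∘ contains3142⇒contains2413) ,
  mk⇔ (_∘ contains3142⇒contains2413) (_∘ contains2413⇒contains3142)
  where
  open DoublyAlternatingPermutation σ da
  avoids2413 : Baxter σ → Avoids σ p2413
  avoids2413 baxter = Baxter⇒no-tight baxter ∘ contains2413⇒tight
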